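{- Let $n\ge 11$ and $S_{1,2}=\{+1,-1,+2,-2\}$. In the Cayley graph $\Gamma(\mathbb Z/n\mathbb Z,S_{1,2})$, every type A edge $\{g,g+1\}$ has Ricci curvature $\kappa=\frac12$ and every type B edge $\{g,g+2\}$ has Ricci curvature $\kappa=0$.
   Context: Let $G=(V,E)$ be a finite connected simple undirected graph with graph distance $d$, $N(x)$ the set of neighbors of $x$, and $\deg(x)=|N(x)|$. For $\alpha\in[0,1]$ and $x\in V$ define the probability measure $\mu_x^\alpha$ on $V$ by $\mu_x^\alpha(x)=\alpha$, $\mu_x^\alpha(v)=\frac{1-\alpha}{\deg(x)}$ for $v\in N(x)$, and $\mu_x^\alpha(v)=0$ otherwise. For probability measures $\mu,\nu$ on $V$, the 1-Wasserstein distance is $W_1(\mu,\nu)=\inf_\pi\sum_{x,y\in V}d(x,y)\pi(x,y)$, the infimum over all $\pi:V\times V\to[0,1]$ with $\sum_y\pi(x,y)=\mu(x)$ and $\sum_x\pi(x,y)=\nu(y)$. For $x\neq y$, $\kappa_\alpha(x,y)=1-\frac{W_1(\mu_x^\alpha,\mu_y^\alpha)}{d(x,y)}$, and the Ricci curvature (of Lin–Lu–Yau) is $\kappa(x,y)=\lim_{\alpha\to1}\frac{\kappa_\alpha(x,y)}{1-\alpha}$. For the additive cyclic group $\mathbb Z/n\mathbb Z$ and a symmetric generating set $S$ not containing $0$, the Cayley graph $\Gamma(\mathbb Z/n\mathbb Z,S)$ is the simple undirected graph with vertex set $\mathbb Z/n\mathbb Z$ and edge set $\{\{g,g+s\}: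 g\in\mathbb Z/n\mathbb Z,\ s\in S\}$.
   Formalization: The parameter α ranges over the rationals in [0,1], the couplings π take rational values, and the limit as α→1 is taken along rational α with rational tolerances. -}

module Defs where

open import Data.Bool using (Bool; true; false; if_then_else_; _∧_; _∨_)
open import Data.Nat as ℕ using (ℕ; zero; suc; NonZero)
open import Data.Nat.DivMod using (_%_; m%n<n)
open import Data.Fin using (Fin; toℕ; fromℕ<)
open import Data.Fin.Properties using () renaming (_≟_ to _≟ᶠ_)
open import Data.List using (List; _∷_; [])
open import Data.Bool.ListAction using (any)
open import Data.Integer using (+_)
open import Data.Rational using (ℚ; 0ℚ; 1ℚ; _+_; _*_; _-_; _÷_; _≤_; _<_; ∣_∣; ≢-nonZero; _/_)
open import Data.Rational.Properties using (_≟_)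
open import Data.Product using (Σ; _×_; ∃)
open import Relation.Nullary using (yes; no; does)
open import Relation.Binary.PropositionalEquality using (_≡_)

ΣF : {n : ℕ} → (Fin n → ℚ) → ℚ
ΣF {zero}  f = 0ℚ
ΣF {suc n} f = f Data.Fin.zero + ΣF (λ i → f (Data.Fin.suc i))

countF : {n : ℕ} → (Fin n → Bool) → ℕ
countF {zero}  p = 0
countF {suc n} p = (if p Data.Fin.zero then 1 else 0) ℕ.+ countF (λ i → p (Data.Fin.suc i))

anyF : {n : ℕ} → (Fin n → Bool) → Bool
anyF {zero}  p = false
anyF {suc n} p = p Data.Fin.zero ∨ anyF (λ i → p (Data.Fin.suc i))

ℕtoℚ : ℕ → ℚ
ℕtoℚ k = + k / 1

-- division of rationals (only ever used with nonzero denominator)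
_÷'_ : ℚ → ℚ → ℚ
p ÷' q with q ≟ 0ℚ
... | yes _  = 0ℚ
... | no q≢0 = _÷_ p q {{≢-nonZero q≢0}}

Adj : ℕ → Set
Adj n = Fin n → Fin n → Bool

eqF : {n : ℕ} → Fin n → Fin n → Bool
eqF i j = does (i ≟ᶠ j)

reach : {n : ℕ} → Adj n → ℕ → Fin n → Fin n → Bool
reach A zero    x y = eqF x y
reach A (suc k) x y = reach A k x y ∨ anyF (λ z → reach A k x z ∧ A z y)

-- graph distance: least k with a walk of length ≤ k (searched up to n,
-- which suffices in a connected graph on n vertices)
distFrom : {n : ℕ} → Adj n → Fin n → Fin n → ℕ → ℕ → ℕ
distFrom A x y k zero       = k
distFrom A x y k (suc fuel) = if reach A k x y then k else distFrom A x y (suc k) fuel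

dist : {n : ℕ} → Adj n → Fin n → Fin n → ℕ
dist {n} A x y = distFrom A x y 0 n

deg : {n : ℕ} → Adj n → Fin n → ℕ
deg A x = countF (A x)

μ : {n : ℕ} → Adj n → ℚ → Fin n → Fin n → ℚ
μ A α x v =
  if eqF x v then α
  else if A x v then (1ℚ - α) ÷' ℕtoℚ (deg A x)
  else 0ℚ

IsCoupling : {n : ℕ} → (Fin n → ℚ) → (Fin n → ℚ) → (Fin n → Fin n → ℚ) → Set
IsCoupling m m' π =
  (∀ x y → 0ℚ ≤ π x y) ×
  (∀ x → ΣF (λ y → π x y) ≡ m x) ×
  (∀ y → ΣF (λ x → π x y) ≡ m' y)

cost : {n : ℕ} → Adj n → (Fin n → Fin n → ℚ) → ℚ
cost A π = ΣF (λ x → ΣF (λ y → ℕtoℚ (dist A x y) * π x y))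

IsW1 : {n : ℕ} → Adj n → (Fin n → ℚ) → (Fin n → ℚ) → ℚ → Set
IsW1 A m m' w =
  (Σ (Fin _ → Fin _ → ℚ) λ π → IsCoupling m m' π × (cost A π ≡ w)) ×
  (∀ π → IsCoupling m m' π → w ≤ cost A π)

κα : {n : ℕ} → Adj n → Fin n → Fin n → ℚ → ℚ
κα A x y w = 1ℚ - (w ÷' ℕtoℚ (dist A x y))

-- Lin–Lu–Yau Ricci curvature κ(x,y) equals L:
-- W₁ exists for all α ∈ [0,1], and κ_α(x,y)/(1-α) → L as α → 1⁻.
RicciIs : {n : ℕ} → Adj n → Fin n → Fin n → ℚ → Set
RicciIs A x y L =
  (∀ α → 0ℚ ≤ α → α ≤ 1ℚ → ∃ λ w → IsW1 A (μ A α x) (μ A α y) w) ×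
  (∀ ε → 0ℚ < ε → Σ ℚ λ δ → 0ℚ < δ ×
     (∀ α → 0ℚ ≤ α → 1ℚ - δ < α → α < 1ℚ →
        ∀ w → IsW1 A (μ A α x) (μ A α y) w →
        ∣ (κα A x y w ÷' (1ℚ - α)) - L ∣ < ε))

-- Cayley graphs of ℤ/nℤ. The generating set S is given by residues in
-- {0,…,n-1}; x ~ y iff y ≡ x + s (mod n) for some s ∈ S.

shift : (n : ℕ) .{{_ : NonZero n}} → Fin n → ℕ → Fin n
shift n g s = fromℕ< (m%n<n (toℕ g ℕ.+ s) n)

cayley : (n : ℕ) .{{_ : NonZero n}} → List ℕ → Adj n
cayley n S x y = any (λ s → eqF (shift n x s) y) S

S₁₂ : ℕ → List ℕ
S₁₂ n = 1 ∷ (n ℕ.∸ 1) ∷ 2 ∷ (n ℕ.∸ 2) ∷ []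

-- For the ends x, y of an edge, W₁(μ_x^α, μ_y^α) is computed exactly for every α ∈ [0, 1] from a
-- primal–dual pair: a transport plan that moves each vertex by at most one generator, and a potential
-- 3 ∸ d(·, Z) that is 1-Lipschitz for the graph distance. On an edge {g, g + 1} one takes Z = {g - 2}
-- and gets W₁ = α + 2β, on an edge {g, g + 2} one takes Z = {g - 2, g - 1} and gets W₁ = α + 4β, where
-- β = (1 - α)/4; hence κ_α = (1 - α)/2 and κ_α = 0 for every α < 1. Both certificates live on the
-- eleven vertices g - 6, …, g + 4, which are distinct because n ≥ 11, so every sum over ℤ/nℤ reduces
-- to a computation on this window; the potentials are at most 1 at both ends of the window, which keeps
-- them 1-Lipschitz across the wrap-around.
module Submission where

open import Defs
open import Data.Bool using (Bool; true; false; if_then_else_; T; _∧_; _∨_)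
open import Data.Bool.ListAction using (any)
open import Data.List using (List; _∷_; [])
open import Data.Bool.Properties using (if-float; if-eta; T-∨; T-∧; T-≡)
open import Data.Nat as ℕ
  using (ℕ; zero; suc; z≤n; s≤s; _≤_; _<_; _≤?_; _<?_; _∸_; _⊔_; ∣_-_∣; ⌈_/2⌉; ⌊_/2⌋; NonZero)
open import Data.Nat.Tactic.RingSolver using (solve-∀)
import Data.Nat.Properties as ℕP
open import Data.Nat.DivMod
  using (_%_; m%n<n; m%n%n≡m%n; %-distribˡ-+; [m+n]%n≡m%n; m<n⇒m%n≡m; m≤n⇒[n∸m]%m≡n%m)
open import Data.Integer as ℤ using (+_)
import Data.Integer.Properties as ℤP
open import Data.Nat.Coprimality as Coprime using (1-coprimeTo)
open import Data.Rational as ℚ using (ℚ; mkℚ; 0ℚ; 1ℚ; _+_; _*_; _-_; -_; _/_; *≤*)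
import Data.Rational.Properties as ℚP
open import Data.Rational.Solver using (module +-*-Solver)
open import Data.Fin as Fin using (Fin; zero; suc; toℕ; fromℕ<)
open import Data.Fin.Patterns using (0F; 1F; 2F)
open import Data.Fin.Properties using (toℕ-fromℕ<; toℕ-injective; toℕ<n)
open import Data.Fin.Permutation using (Permutation; permutation; _⟨$⟩ʳ_)
open import Data.Vec.Functional using (Vector)
open import Function using (_∘_)
open import Data.Product using (_×_; _,_; ∃; proj₁; proj₂)
open import Data.Sum using (_⊎_; inj₁; inj₂)
open import Function.Bundles using (Equivalence)
open import Data.List.Relation.Unary.Any as Any using (here; there)
open import Data.List.Relation.Unary.Any.Properties using (any⁺; any⁻)
open import Data.List.Membership.Propositional using (_∈_)
open import Relation.Binary.PropositionalEquality
open import Relation.Nullary using (yes; no; contradiction)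
open import Relation.Nullary.Decidable using (from-yes; dec-true; dec-false)
open import Algebra.Bundles using (Ring)
open import Algebra.Properties.Semiring.Sum (Ring.semiring ℚP.+-*-ring)
  using (sum; sum-cong-≗; ∑-distrib-+; ∑-comm; sum-permute; *-distribˡ-sum; sum-replicate-zero)

open +-*-Solver using (solve; _:+_; _:*_; _:-_; :-_; _:=_; con)

ℕtoℚ≡mkℚ : ∀ a → ℕtoℚ a ≡ mkℚ (ℤ.+ a) 0 (Coprime.sym (1-coprimeTo a))
ℕtoℚ≡mkℚ a = ℚP.normalize-coprime (Coprime.sym (1-coprimeTo a))

ℕtoℚ-+ : ∀ a b → ℕtoℚ (a ℕ.+ b) ≡ ℕtoℚ a + ℕtoℚ b
ℕtoℚ-+ a b rewrite ℕtoℚ≡mkℚ a | ℕtoℚ≡mkℚ b =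
  cong (ℚ._/ 1) (sym (cong₂ ℤ._+_ (ℤP.*-identityʳ (ℤ.+ a)) (ℤP.*-identityʳ (ℤ.+ b))))

ℕtoℚ-mono-≤ : ∀ {a b} → a ≤ b → ℕtoℚ a ℚ.≤ ℕtoℚ b
ℕtoℚ-mono-≤ {a} {b} a≤b rewrite ℕtoℚ≡mkℚ a | ℕtoℚ≡mkℚ b =
  *≤* (subst₂ ℤ._≤_ (sym (ℤP.*-identityʳ (ℤ.+ a))) (sym (ℤP.*-identityʳ (ℤ.+ b))) (ℤ.+≤+ a≤b))

ℕtoℚ-injective : ∀ {a b} → ℕtoℚ a ≡ ℕtoℚ b → a ≡ b
ℕtoℚ-injective {a} {b} eq rewrite ℕtoℚ≡mkℚ a | ℕtoℚ≡mkℚ b = cong (ℤ.∣_∣ ∘ ℚ.↥_) eq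

+-cancelʳ-≤ : ∀ r {p q} → p + r ℚ.≤ q + r → p ℚ.≤ q
+-cancelʳ-≤ r {p} {q} p+r≤q+r = begin
  p             ≡⟨ solve 2 (λ r p → p := (p :+ r) :- r) refl r p ⟩
  p + r - r     ≤⟨ ℚP.+-monoˡ-≤ (- r) p+r≤q+r ⟩
  q + r - r     ≡⟨ solve 2 (λ r q → (q :+ r) :- r := q) refl r q ⟩
  q             ∎
  where open ℚP.≤-Reasoning

÷'-ℕ-nonNeg : ∀ {p} d → 0ℚ ℚ.≤ p → 0ℚ ℚ.≤ p ÷' ℕtoℚ d
÷'-ℕ-nonNeg zero    p≥0 = ℚP.≤-refl
÷'-ℕ-nonNeg {p} (suc d) p≥0 rewrite ℕtoℚ≡mkℚ (suc d) =
  subst (ℚ._≤ p * 1/d) (ℚP.*-zeroˡ 1/d) (ℚP.*-monoʳ-≤-nonNeg 1/d p≥0)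
  where
  1/d : ℚ
  1/d = ℚ.1/ mkℚ (ℤ.+ suc d) 0 (Coprime.sym (1-coprimeTo (suc d)))

*÷'-cancelʳ : ∀ p {q} → q ≢ 0ℚ → (p * q) ÷' q ≡ p
*÷'-cancelʳ p {q} q≢0 with q ℚP.≟ 0ℚ
... | yes q≡0 = contradiction q≡0 q≢0
... | no  _   = begin
  p * q * ℚ.1/ q    ≡⟨ ℚP.*-assoc p q _ ⟩
  p * (q * ℚ.1/ q)  ≡⟨ cong (p *_) (ℚP.*-inverseʳ q) ⟩
  p * 1ℚ            ≡⟨ ℚP.*-identityʳ p ⟩
  p                 ∎
  where
  open ≡-Reasoning
  instance _ = ℚ.≢-nonZero q≢0

<1⇒1-≢0 : ∀ {α} → α ℚ.< 1ℚ → 1ℚ - α ≢ 0ℚ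
<1⇒1-≢0 {α} α<1 1-α≡0 = ℚP.<-irrefl α≡1 α<1
  where
  α≡1 : α ≡ 1ℚ
  α≡1 = begin
    α                ≡⟨ solve 1 (λ α → α := con 1ℚ :- (con 1ℚ :- α)) refl α ⟩
    1ℚ - (1ℚ - α)    ≡⟨ cong (_-_ 1ℚ) 1-α≡0 ⟩
    1ℚ               ∎
    where open ≡-Reasoning

ΣF≡sum : ∀ {n} (f : Vector ℚ n) → ΣF f ≡ sum f
ΣF≡sum {zero}  f = refl
ΣF≡sum {suc n} f = cong (_+_ (f zero)) (ΣF≡sum (f ∘ suc))

ΣF-cong : ∀ {n} {f g : Vector ℚ n} → (∀ i → f i ≡ g i) → ΣF f ≡ ΣF g
ΣF-cong {f = f} {g} f≗g = begin
  ΣF f  ≡⟨ ΣF≡sum f ⟩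
  sum f ≡⟨ sum-cong-≗ f≗g ⟩
  sum g ≡⟨ ΣF≡sum g ⟨
  ΣF g  ∎
  where open ≡-Reasoning

ΣF-zero : ∀ n → ΣF {n} (λ _ → 0ℚ) ≡ 0ℚ
ΣF-zero n = trans (ΣF≡sum {n} (λ _ → 0ℚ)) (sum-replicate-zero n)

ΣF-distrib-+ : ∀ {n} (f g : Vector ℚ n) → ΣF (λ i → f i + g i) ≡ ΣF f + ΣF g
ΣF-distrib-+ f g = begin
  ΣF (λ i → f i + g i)  ≡⟨ ΣF≡sum (λ i → f i + g i) ⟩
  sum (λ i → f i + g i) ≡⟨ ∑-distrib-+ f g ⟩
  sum f + sum g         ≡⟨ cong₂ _+_ (ΣF≡sum f) (ΣF≡sum g) ⟨
  ΣF f + ΣF g           ∎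
  where open ≡-Reasoning

*-distribˡ-ΣF : ∀ {n} c (f : Vector ℚ n) → c * ΣF f ≡ ΣF (λ i → c * f i)
*-distribˡ-ΣF c f = begin
  c * ΣF f                ≡⟨ cong (c *_) (ΣF≡sum f) ⟩
  c * sum f               ≡⟨ *-distribˡ-sum c f ⟩
  sum (λ i → c * f i)     ≡⟨ ΣF≡sum (λ i → c * f i) ⟨
  ΣF (λ i → c * f i)      ∎
  where open ≡-Reasoning

ΣF-comm : ∀ {m n} (f : Fin m → Fin n → ℚ) →
          ΣF (λ i → ΣF (λ j → f i j)) ≡ ΣF (λ j → ΣF (λ i → f i j))
ΣF-comm f = begin
  ΣF (λ i → ΣF (λ j → f i j))    ≡⟨ ΣF-cong (λ i → ΣF≡sum (f i)) ⟩
  ΣF (λ i → sum (λ j → f i j))   ≡⟨ ΣF≡sum (λ i → sum (f i)) ⟩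
  sum (λ i → sum (λ j → f i j))  ≡⟨ ∑-comm f ⟩
  sum (λ j → sum (λ i → f i j))  ≡⟨ ΣF≡sum (λ j → sum (λ i → f i j)) ⟨
  ΣF (λ j → sum (λ i → f i j))   ≡⟨ ΣF-cong (λ j → ΣF≡sum (λ i → f i j)) ⟨
  ΣF (λ j → ΣF (λ i → f i j))    ∎
  where open ≡-Reasoning

ΣF-permute : ∀ {n} (f : Vector ℚ n) (π : Permutation n n) → ΣF f ≡ ΣF (f ∘ (π ⟨$⟩ʳ_))
ΣF-permute f π = begin
  ΣF f                  ≡⟨ ΣF≡sum f ⟩
  sum f                 ≡⟨ sum-permute f π ⟩
  sum (f ∘ (π ⟨$⟩ʳ_))   ≡⟨ ΣF≡sum (f ∘ (π ⟨$⟩ʳ_)) ⟨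
  ΣF (f ∘ (π ⟨$⟩ʳ_))    ∎
  where open ≡-Reasoning

ΣF-mono-≤ : ∀ {n} {f g : Vector ℚ n} → (∀ i → f i ℚ.≤ g i) → ΣF f ℚ.≤ ΣF g
ΣF-mono-≤ {zero}  f≤g = ℚP.≤-refl
ΣF-mono-≤ {suc n} f≤g = ℚP.+-mono-≤ (f≤g zero) (ΣF-mono-≤ (f≤g ∘ suc))

ΣF-indicator : ∀ {n} (x : Fin n) (f : Vector ℚ n) → ΣF (λ y → if eqF x y then f y else 0ℚ) ≡ f x
ΣF-indicator {suc n} zero    f = trans (cong (_+_ (f zero)) (ΣF-zero n)) (ℚP.+-identityʳ _)
ΣF-indicator {suc n} (suc x) f = trans (ℚP.+-identityˡ _) (ΣF-indicator x (f ∘ suc))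

ΣF-splitAt : ∀ m {n} (h : ℕ → ℚ) →
             ΣF {m ℕ.+ n} (h ∘ toℕ) ≡ ΣF {m} (h ∘ toℕ) + ΣF {n} (λ j → h (m ℕ.+ toℕ j))
ΣF-splitAt zero    h = sym (ℚP.+-identityˡ _)
ΣF-splitAt (suc m) {n} h = trans (cong (_+_ (h 0)) (ΣF-splitAt m (h ∘ suc)))
  (sym (ℚP.+-assoc (h 0) (ΣF {m} (h ∘ suc ∘ toℕ)) (ΣF {n} (λ j → h (suc (m ℕ.+ toℕ j))))))

ΣF-prefix : ∀ {K n} → K ≤ n → (h : ℕ → ℚ) → (∀ m → h (K ℕ.+ m) ≡ 0ℚ) →
            ΣF {n} (h ∘ toℕ) ≡ ΣF {K} (h ∘ toℕ)
ΣF-prefix {K} K≤n h h-vanishes with ℕP.m≤n⇒∃[o]m+o≡n K≤n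
... | r , refl = begin
  ΣF {K ℕ.+ r} (h ∘ toℕ)                            ≡⟨ ΣF-splitAt K h ⟩
  ΣF {K} (h ∘ toℕ) + ΣF {r} (λ j → h (K ℕ.+ toℕ j)) ≡⟨ cong (_+_ (ΣF {K} (h ∘ toℕ)))
                                                         (trans (ΣF-cong {r} (h-vanishes ∘ toℕ)) (ΣF-zero r)) ⟩
  ΣF {K} (h ∘ toℕ) + 0ℚ                             ≡⟨ ℚP.+-identityʳ _ ⟩
  ΣF {K} (h ∘ toℕ)                                  ∎
  where open ≡-Reasoning

ℕtoℚ-countF : ∀ {n} (p : Fin n → Bool) →
              ℕtoℚ (countF p) ≡ ΣF (λ x → if p x then 1ℚ else 0ℚ)
ℕtoℚ-countF {zero}  p = refl
ℕtoℚ-countF {suc n} p = begin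
  ℕtoℚ ((if p zero then 1 else 0) ℕ.+ countF (p ∘ suc))
    ≡⟨ ℕtoℚ-+ (if p zero then 1 else 0) (countF (p ∘ suc)) ⟩
  ℕtoℚ (if p zero then 1 else 0) + ℕtoℚ (countF (p ∘ suc))
    ≡⟨ cong₂ _+_ (if-float ℕtoℚ (p zero)) (ℕtoℚ-countF (p ∘ suc)) ⟩
  (if p zero then 1ℚ else 0ℚ) + ΣF (λ x → if p (suc x) then 1ℚ else 0ℚ) ∎
  where open ≡-Reasoning

μ-nonNeg : ∀ {n} (A : Adj n) {α} → 0ℚ ℚ.≤ α → α ℚ.≤ 1ℚ → ∀ x v → 0ℚ ℚ.≤ μ A α x v
μ-nonNeg A {α} α≥0 α≤1 x v with eqF x v | A x v
... | true  | _     = α≥0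
... | false | true  = ÷'-ℕ-nonNeg (deg A x)
                        (subst (ℚ._≤ 1ℚ - α) (ℚP.+-inverseʳ α) (ℚP.+-monoˡ-≤ (- α) α≤1))
... | false | false = ℚP.≤-refl

transportPlan : ∀ {n} → (Fin n → Fin n) → (Fin n → ℚ) → Fin n → Fin n → ℚ
transportPlan σ m x y = if eqF (σ x) y then m x else 0ℚ

transportPlan-isCoupling : ∀ {n} {σ : Fin n → Fin n} {m m'} → (∀ x → 0ℚ ℚ.≤ m x) →
  (∀ y → ΣF (λ x → transportPlan σ m x y) ≡ m' y) → IsCoupling m m' (transportPlan σ m)
transportPlan-isCoupling {σ = σ} {m} m≥0 pushes-m-to-m' =
  plan≥0 , (λ x → ΣF-indicator (σ x) (λ _ → m x)) , pushes-m-to-m'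
  where
  plan≥0 : ∀ x y → 0ℚ ℚ.≤ transportPlan σ m x y
  plan≥0 x y with eqF (σ x) y
  ... | true  = m≥0 x
  ... | false = ℚP.≤-refl

module _ {n} (A : Adj n) where

  -- The easy half of Kantorovich–Rubinstein duality.
  coupling-cost-lower-bound : ∀ {m m' π} (f : Fin n → ℚ) →
    (∀ x y → f x ℚ.≤ ℕtoℚ (dist A x y) + f y) → IsCoupling m m' π →
    ΣF (λ x → f x * m x) ℚ.≤ cost A π + ΣF (λ y → f y * m' y)
  coupling-cost-lower-bound {m} {m'} {π} f f-lip (π≥0 , row , col) = begin
    ΣF (λ x → f x * m x)
      ≡⟨ ΣF-cong (λ x → trans (cong (f x *_) (sym (row x))) (*-distribˡ-ΣF (f x) (π x))) ⟩
    ΣF (λ x → ΣF (λ y → f x * π x y))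
      ≤⟨ ΣF-mono-≤ (λ x → ΣF-mono-≤ (λ y →
           ℚP.*-monoʳ-≤-nonNeg (π x y) {{ℚ.nonNegative (π≥0 x y)}} (f-lip x y))) ⟩
    ΣF (λ x → ΣF (λ y → (d x y + f y) * π x y))
      ≡⟨ ΣF-cong (λ x → trans (ΣF-cong (λ y → ℚP.*-distribʳ-+ (π x y) (d x y) (f y)))
                              (ΣF-distrib-+ (λ y → d x y * π x y) (λ y → f y * π x y))) ⟩
    ΣF (λ x → ΣF (λ y → d x y * π x y) + ΣF (λ y → f y * π x y))
      ≡⟨ ΣF-distrib-+ (λ x → ΣF (λ y → d x y * π x y)) (λ x → ΣF (λ y → f y * π x y)) ⟩
    cost A π + ΣF (λ x → ΣF (λ y → f y * π x y))
      ≡⟨ cong (_+_ (cost A π)) (trans (ΣF-comm (λ x y → f y * π x y))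
           (ΣF-cong (λ y → trans (sym (*-distribˡ-ΣF (f y) (λ x → π x y))) (cong (f y *_) (col y))))) ⟩
    cost A π + ΣF (λ y → f y * m' y) ∎
    where
    open ℚP.≤-Reasoning
    d : Fin n → Fin n → ℚ
    d x y = ℕtoℚ (dist A x y)

  IsW1-intro : ∀ {m m' π} w (f : Fin n → ℚ) → IsCoupling m m' π → cost A π ≡ w →
    (∀ x y → f x ℚ.≤ ℕtoℚ (dist A x y) + f y) →
    ΣF (λ x → f x * m x) ≡ w + ΣF (λ y → f y * m' y) → IsW1 A m m' w
  IsW1-intro {m' = m'} {π} w f π-coupling π-cost f-lip f-gap =
    (π , π-coupling , π-cost) ,
    λ π' π'-coupling → +-cancelʳ-≤ (ΣF (λ y → f y * m' y))
      (subst (ℚ._≤ _) f-gap (coupling-cost-lower-bound f f-lip π'-coupling))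

  IsW1-unique : ∀ {m m' w w'} → IsW1 A m m' w → IsW1 A m m' w' → w ≡ w'
  IsW1-unique {w = w} {w'} ((π , π-coupling , π-cost) , w-min) ((π' , π'-coupling , π'-cost) , w'-min) =
    ℚP.≤-antisym (subst (w ℚ.≤_) π'-cost (w-min π' π'-coupling))
                 (subst (w' ℚ.≤_) π-cost (w'-min π π-coupling))

  cost-transportPlan : ∀ σ m →
    cost A (transportPlan σ m) ≡ ΣF (λ x → ℕtoℚ (dist A x (σ x)) * m x)
  cost-transportPlan σ m = ΣF-cong λ x →
    trans (ΣF-cong (λ y → *-if (ℕtoℚ (dist A x y)) (eqF (σ x) y)))
          (ΣF-indicator (σ x) (λ y → ℕtoℚ (dist A x y) * m x))
    where
    *-if : ∀ r {s} b → r * (if b then s else 0ℚ) ≡ (if b then r * s else 0ℚ)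
    *-if r true  = refl
    *-if r false = ℚP.*-zeroʳ r

-- If 1 - W₁ is linear in 1 - α then κ_α/(1 - α) is constant for α < 1, so the limit needs no analysis.
RicciIs-intro : ∀ {n} (A : Adj n) x y (W : ℚ → ℚ) L → dist A x y ≡ 1 →
  (∀ α → 0ℚ ℚ.≤ α → α ℚ.≤ 1ℚ → IsW1 A (μ A α x) (μ A α y) (W α)) →
  (∀ α → 1ℚ - W α ≡ L * (1ℚ - α)) → RicciIs A x y L
RicciIs-intro A x y W L dist≡1 W-isW1 W-affine =
  (λ α α≥0 α≤1 → W α , W-isW1 α α≥0 α≤1) ,
  λ ε ε>0 → 1ℚ , from-yes (0ℚ ℚP.<? 1ℚ) , λ α α≥0 _ α<1 w w-isW1 →
    subst (λ κ → ℚ.∣ κ - L ∣ ℚ.< ε) (sym (κα≡L α α≥0 α<1 w w-isW1))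
      (subst (λ z → ℚ.∣ z ∣ ℚ.< ε) (sym (ℚP.+-inverseʳ L)) ε>0)
  where
  κα≡L : ∀ α → 0ℚ ℚ.≤ α → α ℚ.< 1ℚ → ∀ w → IsW1 A (μ A α x) (μ A α y) w →
         κα A x y w ÷' (1ℚ - α) ≡ L
  κα≡L α α≥0 α<1 w w-isW1 = begin
    κα A x y w ÷' (1ℚ - α)       ≡⟨ cong (λ d → (1ℚ - w ÷' ℕtoℚ d) ÷' (1ℚ - α)) dist≡1 ⟩
    (1ℚ - w * 1ℚ) ÷' (1ℚ - α)    ≡⟨ cong (λ v → (1ℚ - v) ÷' (1ℚ - α)) (ℚP.*-identityʳ w) ⟩
    (1ℚ - w) ÷' (1ℚ - α)         ≡⟨ cong (λ v → (1ℚ - v) ÷' (1ℚ - α))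
                                      (IsW1-unique A w-isW1 (W-isW1 α α≥0 (ℚP.<⇒≤ α<1))) ⟩
    (1ℚ - W α) ÷' (1ℚ - α)       ≡⟨ cong (_÷' (1ℚ - α)) (W-affine α) ⟩
    (L * (1ℚ - α)) ÷' (1ℚ - α)   ≡⟨ *÷'-cancelʳ L (<1⇒1-≢0 α<1) ⟩
    L                            ∎
    where open ≡-Reasoning

eqF-refl : ∀ {n} (x : Fin n) → eqF x x ≡ true
eqF-refl x = dec-true (x Fin.≟ x) refl

eqF⇒≡ : ∀ {n} {x y : Fin n} → T (eqF x y) → x ≡ y
eqF⇒≡ {x = x} {y} _ with x Fin.≟ y
... | yes x≡y = x≡y

anyF⁺ : ∀ {n} (p : Fin n → Bool) z → T (p z) → T (anyF p)
anyF⁺ p zero    pz = Equivalence.from T-∨ (inj₁ pz)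
anyF⁺ p (suc z) pz = Equivalence.from T-∨ (inj₂ (anyF⁺ (p ∘ suc) z pz))

anyF⁻ : ∀ {n} (p : Fin n → Bool) → T (anyF p) → ∃ λ z → T (p z)
anyF⁻ {suc n} p any-p with Equivalence.to T-∨ any-p
... | inj₁ p0 = zero , p0
... | inj₂ any-p' = let z , pz = anyF⁻ (p ∘ suc) any-p' in suc z , pz

dist-refl : ∀ {n} (A : Adj n) x → dist A x x ≡ 0
dist-refl {suc n} A x rewrite eqF-refl x = refl

dist-edge : ∀ {n} (A : Adj n) {x y} → T (A x y) → x ≢ y → dist A x y ≡ 1
dist-edge {suc zero}    A {zero} {zero} _   x≢y = contradiction refl x≢y
dist-edge {suc (suc n)} A {x} {y}       Axy x≢y
  rewrite dec-false (x Fin.≟ y) x≢y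
        | Equivalence.to T-≡ (anyF⁺ (λ z → eqF x z ∧ A z y) x
                                    (subst (λ b → T (b ∧ A x y)) (sym (eqF-refl x)) Axy))
  = refl

module _ {n} (A : Adj n) (φ : Fin n → ℕ) (φ-edge : ∀ x y → T (A x y) → φ x ≤ suc (φ y)) where

  private
    reach-lipschitz : ∀ k x y → T (reach A k x y) → φ x ≤ k ℕ.+ φ y
    reach-lipschitz zero    x y x≡y = ℕP.≤-reflexive (cong φ (eqF⇒≡ x≡y))
    reach-lipschitz (suc k) x y r with Equivalence.to T-∨ r
    ... | inj₁ r-k = ℕP.m≤n⇒m≤1+n (reach-lipschitz k x y r-k)
    ... | inj₂ r-step with anyF⁻ (λ z → reach A k x z ∧ A z y) r-step
    ...   | z , rz∧Azy with Equivalence.to T-∧ rz∧Azy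
    ...     | r-z , Azy = begin
      φ x               ≤⟨ reach-lipschitz k x z r-z ⟩
      k ℕ.+ φ z         ≤⟨ ℕP.+-monoʳ-≤ k (φ-edge z y Azy) ⟩
      k ℕ.+ suc (φ y)   ≡⟨ ℕP.+-suc k (φ y) ⟩
      suc k ℕ.+ φ y     ∎
      where open ℕP.≤-Reasoning

    distFrom-cases : ∀ x y k fuel →
      T (reach A (distFrom A x y k fuel) x y) ⊎ distFrom A x y k fuel ≡ k ℕ.+ fuel
    distFrom-cases x y k zero = inj₂ (sym (ℕP.+-identityʳ k))
    distFrom-cases x y k (suc fuel) with reach A k x y in reach≡
    ... | true  = inj₁ (Equivalence.from T-≡ reach≡)
    ... | false with distFrom-cases x y (suc k) fuel
    ...   | inj₁ r = inj₁ r
    ...   | inj₂ d = inj₂ (trans d (sym (ℕP.+-suc k fuel)))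

  -- φ ≤ n covers the pairs that no walk of length < n joins, where dist takes the value n.
  dist-lipschitz : (∀ x → φ x ≤ n) → ∀ x y → φ x ≤ dist A x y ℕ.+ φ y
  dist-lipschitz φ≤n x y with distFrom-cases x y 0 n
  ... | inj₁ r = reach-lipschitz _ x y r
  ... | inj₂ d rewrite d = ℕP.≤-trans (φ≤n x) (ℕP.m≤m+n n (φ y))

module _ {n : ℕ} .{{_ : NonZero n}} where

  [m%n+k]%n≡[m+k]%n : ∀ m k → (m % n ℕ.+ k) % n ≡ (m ℕ.+ k) % n
  [m%n+k]%n≡[m+k]%n m k = begin
    (m % n ℕ.+ k) % n             ≡⟨ %-distribˡ-+ (m % n) k n ⟩
    (m % n % n ℕ.+ k % n) % n     ≡⟨ cong (λ r → (r ℕ.+ k % n) % n) (m%n%n≡m%n m n) ⟩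
    (m % n ℕ.+ k % n) % n         ≡⟨ %-distribˡ-+ m k n ⟨
    (m ℕ.+ k) % n                 ∎
    where open ≡-Reasoning

  [m+k%n]%n≡[m+k]%n : ∀ m k → (m ℕ.+ k % n) % n ≡ (m ℕ.+ k) % n
  [m+k%n]%n≡[m+k]%n m k = begin
    (m ℕ.+ k % n) % n  ≡⟨ cong (_% n) (ℕP.+-comm m (k % n)) ⟩
    (k % n ℕ.+ m) % n  ≡⟨ [m%n+k]%n≡[m+k]%n k m ⟩
    (k ℕ.+ m) % n      ≡⟨ cong (_% n) (ℕP.+-comm k m) ⟩
    (m ℕ.+ k) % n      ∎
    where open ≡-Reasoning

  toℕ-shift : ∀ (x : Fin n) s → toℕ (shift n x s) ≡ (toℕ x ℕ.+ s) % n
  toℕ-shift x s = toℕ-fromℕ< (m%n<n (toℕ x ℕ.+ s) n)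

  shift-shift : ∀ (x : Fin n) a c → shift n (shift n x a) c ≡ shift n x (a ℕ.+ c)
  shift-shift x a c = toℕ-injective (begin
    toℕ (shift n (shift n x a) c)      ≡⟨ toℕ-shift (shift n x a) c ⟩
    (toℕ (shift n x a) ℕ.+ c) % n      ≡⟨ cong (λ r → (r ℕ.+ c) % n) (toℕ-shift x a) ⟩
    ((toℕ x ℕ.+ a) % n ℕ.+ c) % n      ≡⟨ [m%n+k]%n≡[m+k]%n (toℕ x ℕ.+ a) c ⟩
    (toℕ x ℕ.+ a ℕ.+ c) % n            ≡⟨ cong (_% n) (ℕP.+-assoc (toℕ x) a c) ⟩
    (toℕ x ℕ.+ (a ℕ.+ c)) % n          ≡⟨ toℕ-shift x (a ℕ.+ c) ⟨
    toℕ (shift n x (a ℕ.+ c))          ∎)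
    where open ≡-Reasoning

  shift-+n : ∀ (x : Fin n) a → shift n x (a ℕ.+ n) ≡ shift n x a
  shift-+n x a = toℕ-injective (begin
    toℕ (shift n x (a ℕ.+ n))     ≡⟨ toℕ-shift x (a ℕ.+ n) ⟩
    (toℕ x ℕ.+ (a ℕ.+ n)) % n     ≡⟨ cong (_% n) (ℕP.+-assoc (toℕ x) a n) ⟨
    (toℕ x ℕ.+ a ℕ.+ n) % n       ≡⟨ [m+n]%n≡m%n (toℕ x ℕ.+ a) n ⟩
    (toℕ x ℕ.+ a) % n             ≡⟨ toℕ-shift x a ⟨
    toℕ (shift n x a)             ∎)
    where open ≡-Reasoning

  shift-0 : ∀ (x : Fin n) → shift n x 0 ≡ x
  shift-0 x = toℕ-injective (trans (toℕ-shift x 0)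
    (trans (cong (_% n) (ℕP.+-identityʳ (toℕ x))) (m<n⇒m%n≡m (toℕ<n x))))

  shift-cancel : ∀ (x : Fin n) {c} → c ≤ n → shift n (shift n x (n ∸ c)) c ≡ x
  shift-cancel x {c} c≤n = begin
    shift n (shift n x (n ∸ c)) c   ≡⟨ shift-shift x (n ∸ c) c ⟩
    shift n x (n ∸ c ℕ.+ c)         ≡⟨ cong (shift n x) (ℕP.m∸n+n≡m c≤n) ⟩
    shift n x (0 ℕ.+ n)             ≡⟨ shift-+n x 0 ⟩
    shift n x 0                     ≡⟨ shift-0 x ⟩
    x                               ∎
    where open ≡-Reasoning

  +-%-cases : ∀ {i} r → i < n → r ≤ n →
    (i ℕ.+ r < n × (i ℕ.+ r) % n ≡ i ℕ.+ r) ⊎ (n ≤ i ℕ.+ r × (i ℕ.+ r) % n ≡ i ℕ.+ r ∸ n)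
  +-%-cases {i} r i<n r≤n with i ℕ.+ r <? n
  ... | yes i+r<n = inj₁ (i+r<n , m<n⇒m%n≡m i+r<n)
  ... | no  i+r≮n = inj₂ (n≤i+r , trans (sym (m≤n⇒[n∸m]%m≡n%m n≤i+r)) (m<n⇒m%n≡m i+r∸n<n))
    where
    n≤i+r : n ≤ i ℕ.+ r
    n≤i+r = ℕP.≮⇒≥ i+r≮n
    i+r∸n<n : i ℕ.+ r ∸ n < n
    i+r∸n<n = ℕP.≤-<-trans (ℕP.∸-monoˡ-≤ n (ℕP.+-monoʳ-≤ i r≤n))
                           (subst (_< n) (sym (ℕP.m+n∸n≡m i n)) i<n)

  +-%-≢ : ∀ {i} r → 0 < r → r < n → i < n → (i ℕ.+ r) % n ≢ i
  +-%-≢ {i} r r>0 r<n i<n with +-%-cases r i<n (ℕP.<⇒≤ r<n)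
  ... | inj₁ (_ , i+r%n≡i+r) = λ eq →
          ℕP.<-irrefl (sym (ℕP.+-cancelˡ-≡ i r 0
            (trans (sym i+r%n≡i+r) (trans eq (sym (ℕP.+-identityʳ i)))))) r>0
  ... | inj₂ (n≤i+r , i+r%n≡i+r∸n) = λ eq →
          ℕP.<-irrefl (ℕP.+-cancelˡ-≡ i r n (begin
            i ℕ.+ r                 ≡⟨ ℕP.m∸n+n≡m n≤i+r ⟨
            i ℕ.+ r ∸ n ℕ.+ n       ≡⟨ cong (ℕ._+ n) (trans (sym i+r%n≡i+r∸n) eq) ⟩
            i ℕ.+ n                 ∎)) r<n
    where open ≡-Reasoning

  [a+[n∸r]]%n≡a∸r : ∀ {a r} → r ≤ a → a < n → (a ℕ.+ (n ∸ r)) % n ≡ a ∸ r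
  [a+[n∸r]]%n≡a∸r {a} {r} r≤a a<n = begin
    (a ℕ.+ (n ∸ r)) % n              ≡⟨ cong (λ z → (z ℕ.+ (n ∸ r)) % n) (ℕP.m∸n+n≡m r≤a) ⟨
    (a ∸ r ℕ.+ r ℕ.+ (n ∸ r)) % n    ≡⟨ cong (_% n) (ℕP.+-assoc (a ∸ r) r (n ∸ r)) ⟩
    (a ∸ r ℕ.+ (r ℕ.+ (n ∸ r))) % n  ≡⟨ cong (λ z → (a ∸ r ℕ.+ z) % n)
                                              (ℕP.m+[n∸m]≡n (ℕP.≤-trans r≤a (ℕP.<⇒≤ a<n))) ⟩
    (a ∸ r ℕ.+ n) % n                ≡⟨ [m+n]%n≡m%n (a ∸ r) n ⟩
    (a ∸ r) % n                      ≡⟨ m<n⇒m%n≡m (ℕP.≤-<-trans (ℕP.m∸n≤m a r) a<n) ⟩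
    a ∸ r                            ∎
    where open ≡-Reasoning

module Offsets (n : ℕ) .{{_ : NonZero n}} (b : Fin n) where

  vertex : ℕ → Fin n
  vertex m = shift n b m

  offset : Fin n → ℕ
  offset x = (toℕ x ℕ.+ (n ∸ toℕ b)) % n

  offset<n : ∀ x → offset x < n
  offset<n x = m%n<n (toℕ x ℕ.+ (n ∸ toℕ b)) n

  private
    b+[n∸b]≡n : toℕ b ℕ.+ (n ∸ toℕ b) ≡ n
    b+[n∸b]≡n = ℕP.m+[n∸m]≡n (ℕP.<⇒≤ (toℕ<n b))

  offset-vertex : ∀ {m} → m < n → offset (vertex m) ≡ m
  offset-vertex {m} m<n = begin
    offset (vertex m)                        ≡⟨ cong (λ r → (r ℕ.+ (n ∸ toℕ b)) % n) (toℕ-shift b m) ⟩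
    ((toℕ b ℕ.+ m) % n ℕ.+ (n ∸ toℕ b)) % n  ≡⟨ [m%n+k]%n≡[m+k]%n (toℕ b ℕ.+ m) _ ⟩
    (toℕ b ℕ.+ m ℕ.+ (n ∸ toℕ b)) % n        ≡⟨ cong (_% n) (+-rearrange (toℕ b) m _) ⟩
    (m ℕ.+ (toℕ b ℕ.+ (n ∸ toℕ b))) % n      ≡⟨ cong (λ r → (m ℕ.+ r) % n) b+[n∸b]≡n ⟩
    (m ℕ.+ n) % n                            ≡⟨ [m+n]%n≡m%n m n ⟩
    m % n                                    ≡⟨ m<n⇒m%n≡m m<n ⟩
    m                                        ∎
    where
    open ≡-Reasoning
    +-rearrange : ∀ u v w → u ℕ.+ v ℕ.+ w ≡ v ℕ.+ (u ℕ.+ w)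
    +-rearrange = solve-∀

  vertex-offset : ∀ x → vertex (offset x) ≡ x
  vertex-offset x = toℕ-injective (begin
    toℕ (vertex (offset x))                       ≡⟨ toℕ-shift b (offset x) ⟩
    (toℕ b ℕ.+ (toℕ x ℕ.+ (n ∸ toℕ b)) % n) % n  ≡⟨ [m+k%n]%n≡[m+k]%n (toℕ b) _ ⟩
    (toℕ b ℕ.+ (toℕ x ℕ.+ (n ∸ toℕ b))) % n      ≡⟨ cong (_% n) (+-rearrange (toℕ b) (toℕ x) _) ⟩
    (toℕ x ℕ.+ (toℕ b ℕ.+ (n ∸ toℕ b))) % n      ≡⟨ cong (λ r → (toℕ x ℕ.+ r) % n) b+[n∸b]≡n ⟩
    (toℕ x ℕ.+ n) % n                            ≡⟨ [m+n]%n≡m%n (toℕ x) n ⟩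
    toℕ x % n                                    ≡⟨ m<n⇒m%n≡m (toℕ<n x) ⟩
    toℕ x                                        ∎)
    where
    open ≡-Reasoning
    +-rearrange : ∀ u v w → u ℕ.+ (v ℕ.+ w) ≡ v ℕ.+ (u ℕ.+ w)
    +-rearrange = solve-∀

  vertex-shift : ∀ a s → shift n (vertex a) s ≡ vertex ((a ℕ.+ s) % n)
  vertex-shift a s = trans (shift-shift b a s) (toℕ-injective (begin
    toℕ (shift n b (a ℕ.+ s))              ≡⟨ toℕ-shift b (a ℕ.+ s) ⟩
    (toℕ b ℕ.+ (a ℕ.+ s)) % n              ≡⟨ [m+k%n]%n≡[m+k]%n (toℕ b) (a ℕ.+ s) ⟨
    (toℕ b ℕ.+ (a ℕ.+ s) % n) % n          ≡⟨ toℕ-shift b ((a ℕ.+ s) % n) ⟨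
    toℕ (vertex ((a ℕ.+ s) % n))           ∎))
    where open ≡-Reasoning

  offset-shift : ∀ x s → offset (shift n x s) ≡ (offset x ℕ.+ s) % n
  offset-shift x s = begin
    offset (shift n x s)                        ≡⟨ cong (λ y → offset (shift n y s)) (vertex-offset x) ⟨
    offset (shift n (vertex (offset x)) s)      ≡⟨ cong offset (vertex-shift (offset x) s) ⟩
    offset (vertex ((offset x ℕ.+ s) % n))      ≡⟨ offset-vertex (m%n<n (offset x ℕ.+ s) n) ⟩
    (offset x ℕ.+ s) % n                        ∎
    where open ≡-Reasoning

  eqF-vertex : ∀ {a} → a < n → ∀ y → eqF (vertex a) y ≡ (a ℕ.≡ᵇ offset y)
  eqF-vertex {a} a<n y with vertex a Fin.≟ y
  ... | yes refl = sym (Equivalence.to T-≡ (ℕP.≡⇒≡ᵇ a _ (sym (offset-vertex a<n))))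
  ... | no  a≢y  =
    sym (dec-false (a ℕ.≟ offset y) λ a≡y′ → a≢y (trans (cong vertex a≡y′) (vertex-offset y)))

  ΣF-offset : ∀ (h : ℕ → ℚ) → ΣF (λ x → h (offset x)) ≡ ΣF {n} (h ∘ toℕ)
  ΣF-offset h = trans (ΣF-permute (h ∘ offset) translation)
                      (ΣF-cong (λ i → cong h (offset-vertex (toℕ<n i))))
    where
    translation : Permutation n n
    translation = permutation (vertex ∘ toℕ) (λ x → fromℕ< (offset<n x))
      (λ x → trans (cong vertex (toℕ-fromℕ< (offset<n x))) (vertex-offset x))
      (λ i → toℕ-injective (trans (toℕ-fromℕ< (offset<n (vertex (toℕ i))))
                                  (offset-vertex (toℕ<n i))))

NearSeam : ℕ → ℕ → Set
NearSeam n m = m ≤ 1 ⊎ n ≤ m ℕ.+ 2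

module _ {n : ℕ} .{{_ : NonZero n}} where

  +%-close-or-seam : ∀ {i} r → r ≤ 2 → 2 ≤ n → i < n →
    ∣ i - (i ℕ.+ r) % n ∣ ≤ 2 ⊎ (NearSeam n i × NearSeam n ((i ℕ.+ r) % n))
  +%-close-or-seam {i} r r≤2 2≤n i<n with +-%-cases r i<n (ℕP.≤-trans r≤2 2≤n)
  ... | inj₁ (_ , i+r%n≡i+r) rewrite i+r%n≡i+r = inj₁ (subst (_≤ 2) (sym (ℕP.∣m-m+n∣≡n i r)) r≤2)
  ... | inj₂ (n≤i+r , i+r%n≡i+r∸n) rewrite i+r%n≡i+r∸n =
          inj₂ (inj₂ (ℕP.≤-trans n≤i+r i+r≤i+2) , inj₁ (begin
            i ℕ.+ r ∸ n      ≤⟨ ℕP.∸-monoˡ-≤ n (subst (i ℕ.+ r ≤_) (ℕP.+-comm i 2) i+r≤i+2) ⟩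
            suc (suc i) ∸ n  ≤⟨ ℕP.∸-monoˡ-≤ n (s≤s i<n) ⟩
            suc n ∸ n        ≡⟨ ℕP.m+n∸n≡m 1 n ⟩
            1                ∎))
    where
    open ℕP.≤-Reasoning
    i+r≤i+2 : i ℕ.+ r ≤ i ℕ.+ 2
    i+r≤i+2 = ℕP.+-monoʳ-≤ i r≤2

  cayley-shift : ∀ S (x : Fin n) {s} → s ∈ S → T (cayley n S x (shift n x s))
  cayley-shift S x {s} s∈S = any⁺ (λ s′ → eqF (shift n x s′) (shift n x s))
    (Any.map (λ { refl → Equivalence.from T-≡ (eqF-refl (shift n x s)) }) s∈S)

  shift-≢ : ∀ (x : Fin n) {h} → 0 < h → h < n → x ≢ shift n x h
  shift-≢ x {h} h>0 h<n x≡x+h =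
    +-%-≢ h h>0 h<n (toℕ<n x) (sym (trans (cong toℕ x≡x+h) (toℕ-shift x h)))

  shift-∸-back : ∀ {x y : Fin n} {r} → r ≤ n → T (eqF (shift n x (n ∸ r)) y) → x ≡ shift n y r
  shift-∸-back {x} {y} {r} r≤n x-r≡y =
    trans (sym (shift-cancel x r≤n)) (cong (λ z → shift n z r) (eqF⇒≡ x-r≡y))

  S₁₂-adjacent : 2 ≤ n → ∀ {x y} → T (cayley n (S₁₂ n) x y) →
    ∃ λ r → r ≤ 2 × (y ≡ shift n x r ⊎ x ≡ shift n y r)
  S₁₂-adjacent 2≤n {x} {y} x~y with any⁻ (λ s → eqF (shift n x s) y) (S₁₂ n) x~y
  ... | here x+1≡y                         = 1 , s≤s z≤n , inj₁ (sym (eqF⇒≡ x+1≡y))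
  ... | there (here x-1≡y)                 = 1 , s≤s z≤n , inj₂ (shift-∸-back (ℕP.<⇒≤ 2≤n) x-1≡y)
  ... | there (there (here x+2≡y))         = 2 , ℕP.≤-refl , inj₁ (sym (eqF⇒≡ x+2≡y))
  ... | there (there (there (here x-2≡y))) = 2 , ℕP.≤-refl , inj₂ (shift-∸-back 2≤n x-2≡y)

  dist-shift : 3 ≤ n → ∀ (x : Fin n) {h} → h ≤ 2 →
               dist (cayley n (S₁₂ n)) x (shift n x h) ≡ ⌈ h /2⌉
  dist-shift 3≤n x {0} _ rewrite shift-0 x = dist-refl _ x
  dist-shift 3≤n x {1} _ =
    dist-edge _ (cayley-shift (S₁₂ n) x (here refl))
                (shift-≢ x (s≤s z≤n) (ℕP.≤-trans (s≤s (s≤s z≤n)) 3≤n))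
  dist-shift 3≤n x {2} _ =
    dist-edge _ (cayley-shift (S₁₂ n) x (there (there (here refl)))) (shift-≢ x (s≤s z≤n) 3≤n)
  dist-shift 3≤n x {suc (suc (suc h))} (s≤s (s≤s ()))

-- 1-Lipschitz for the metric ⌈ ∣ i - j ∣ /2⌉ on ℕ, the path metric of the steps ±1, ±2.
Lipschitz₂ : (ℕ → ℕ) → Set
Lipschitz₂ φ = ∀ i j → ∣ i - j ∣ ≤ 2 → φ i ≤ suc (φ j)

⊔-lipschitz : ∀ {φ ψ} → Lipschitz₂ φ → Lipschitz₂ ψ → Lipschitz₂ (λ m → φ m ⊔ ψ m)
⊔-lipschitz φ-lip ψ-lip i j i~j = ℕP.⊔-mono-≤ (φ-lip i j i~j) (ψ-lip i j i~j)

cone : ℕ → ℕ → ℕ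
cone z m = 3 ∸ ⌈ ∣ m - z ∣ /2⌉

cone-lipschitz : ∀ z → Lipschitz₂ (cone z)
cone-lipschitz z i j i~j =
  ℕP.≤-trans (ℕP.∸-monoʳ-≤ 4 ⌈j-z/2⌉≤1+⌈i-z/2⌉) (suc-∸-≤ 3 ⌈ ∣ j - z ∣ /2⌉)
  where
  suc-∸-≤ : ∀ c b → suc c ∸ b ≤ suc (c ∸ b)
  suc-∸-≤ c       zero    = ℕP.≤-refl
  suc-∸-≤ zero    (suc b) = ℕP.≤-trans (ℕP.m∸n≤m 0 b) z≤n
  suc-∸-≤ (suc c) (suc b) = suc-∸-≤ c b
  ⌈j-z/2⌉≤1+⌈i-z/2⌉ : ⌈ ∣ j - z ∣ /2⌉ ≤ suc ⌈ ∣ i - z ∣ /2⌉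
  ⌈j-z/2⌉≤1+⌈i-z/2⌉ = ℕP.⌈n/2⌉-mono (begin
    ∣ j - z ∣              ≤⟨ ℕP.∣-∣-triangle j i z ⟩
    ∣ j - i ∣ ℕ.+ ∣ i - z ∣ ≤⟨ ℕP.+-monoˡ-≤ ∣ i - z ∣ (subst (_≤ 2) (ℕP.∣-∣-comm i j) i~j) ⟩
    2 ℕ.+ ∣ i - z ∣        ∎)
    where open ℕP.≤-Reasoning

cone-≤3 : ∀ z m → cone z m ≤ 3
cone-≤3 z m = ℕP.m∸n≤m 3 ⌈ ∣ m - z ∣ /2⌉

cones-seam : ∀ m → m ≤ 1 ⊎ 9 ≤ m → cone 4 m ⊔ cone 5 m ≤ 1
cones-seam 0 _ = ℕP.≤-refl
cones-seam 1 _ = ℕP.≤-refl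
cones-seam (suc (suc m)) (inj₁ (s≤s ()))
cones-seam m (inj₂ 9≤m) with ℕP.m≤n⇒∃[o]m+o≡n 9≤m
... | x , refl = ℕP.⊔-lub (ℕP.≤-trans (ℕP.m∸n≤m 0 ⌊ x /2⌋) z≤n) (ℕP.m∸n≤m 1 ⌊ suc x /2⌋)

close-or-seam⇒lipschitz : ∀ {n φ} → Lipschitz₂ φ → (∀ m → NearSeam n m → φ m ≤ 1) →
  ∀ {i j} → ∣ i - j ∣ ≤ 2 ⊎ (NearSeam n i × NearSeam n j) → φ i ≤ suc (φ j) × φ j ≤ suc (φ i)
close-or-seam⇒lipschitz φ-lip φ-seam {i} {j} (inj₁ i~j) =
  φ-lip i j i~j , φ-lip j i (subst (_≤ 2) (ℕP.∣-∣-comm i j) i~j)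
close-or-seam⇒lipschitz φ-lip φ-seam (inj₂ (i-seam , j-seam)) =
  ℕP.≤-trans (φ-seam _ i-seam) (s≤s z≤n) , ℕP.≤-trans (φ-seam _ j-seam) (s≤s z≤n)

module _ {n : ℕ} .{{_ : NonZero n}} (b : Fin n) where
  open Offsets n b

  offset-lipschitz : 2 ≤ n → ∀ {φ} → Lipschitz₂ φ → (∀ m → NearSeam n m → φ m ≤ 1) →
    ∀ x y → T (cayley n (S₁₂ n) x y) → φ (offset x) ≤ suc (φ (offset y))
  offset-lipschitz 2≤n φ-lip φ-seam x y x~y with S₁₂-adjacent 2≤n x~y
  ... | r , r≤2 , inj₁ refl rewrite offset-shift x r =
    proj₁ (close-or-seam⇒lipschitz φ-lip φ-seam (+%-close-or-seam r r≤2 2≤n (offset<n x)))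
  ... | r , r≤2 , inj₂ refl rewrite offset-shift y r =
    proj₂ (close-or-seam⇒lipschitz φ-lip φ-seam (+%-close-or-seam r r≤2 2≤n (offset<n y)))

-- Masses c₁ α + c₂ β, recorded by their coefficients (c₁ , c₂), where β = (1 - α)/4 is the
-- mass that μ^α puts on each neighbour of a vertex of degree 4.
Form : Set
Form = ℚ × ℚ

𝟘 α̂ β̂ : Form
𝟘 = 0ℚ , 0ℚ
α̂ = 1ℚ , 0ℚ
β̂ = 0ℚ , 1ℚ

_⊕_ : Form → Form → Form
(a , b) ⊕ (c , d) = a + c , b + d

_⊙_ : ℚ → Form → Form
q ⊙ (a , b) = q * a , q * b

⊙-zeroʳ : ∀ q → q ⊙ 𝟘 ≡ 𝟘
⊙-zeroʳ q = cong₂ _,_ (ℚP.*-zeroʳ q) (ℚP.*-zeroʳ q)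

ΣForm : ∀ {K} → (Fin K → Form) → Form
ΣForm v = ΣF (proj₁ ∘ v) , ΣF (proj₂ ∘ v)

β : ℚ → ℚ
β α = (1ℚ - α) ÷' ℕtoℚ 4

⟦_⟧ : Form → ℚ → ℚ
⟦ a , b ⟧ α = a * α + b * β α

⟦𝟘⟧ : ∀ α → ⟦ 𝟘 ⟧ α ≡ 0ℚ
⟦𝟘⟧ α = solve 2 (λ α β → con 0ℚ :* α :+ con 0ℚ :* β := con 0ℚ) refl α (β α)

⟦⊕⟧ : ∀ u v α → ⟦ u ⊕ v ⟧ α ≡ ⟦ u ⟧ α + ⟦ v ⟧ α
⟦⊕⟧ (a , b) (c , d) α =
  solve 6 (λ a b c d α β → (a :+ c) :* α :+ (b :+ d) :* β := (a :* α :+ b :* β) :+ (c :* α :+ d :* β))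
    refl a b c d α (β α)

⟦⊙⟧ : ∀ q v α → ⟦ q ⊙ v ⟧ α ≡ q * ⟦ v ⟧ α
⟦⊙⟧ q (a , b) α =
  solve 5 (λ q a b α β → (q :* a) :* α :+ (q :* b) :* β := q :* (a :* α :+ b :* β)) refl q a b α (β α)

ΣF-⟦⟧ : ∀ {K} (v : Fin K → Form) α → ΣF (λ i → ⟦ v i ⟧ α) ≡ ⟦ ΣForm v ⟧ α
ΣF-⟦⟧ {zero}  v α = sym (⟦𝟘⟧ α)
ΣF-⟦⟧ {suc K} v α =
  trans (cong (_+_ (⟦ v zero ⟧ α)) (ΣF-⟦⟧ (v ∘ suc) α)) (sym (⟦⊕⟧ (v zero) (ΣForm (v ∘ suc)) α))

neighbours : ℕ → List ℕ
neighbours a = a ℕ.+ 1 ∷ a ∸ 1 ∷ a ℕ.+ 2 ∷ a ∸ 2 ∷ []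

isNeighbour : ℕ → ℕ → Bool
isNeighbour a m = any (ℕ._≡ᵇ m) (neighbours a)

module Window (n : ℕ) .{{_ : NonZero n}} (11≤n : 11 ≤ n) (b : Fin n) where
  open Offsets n b public

  G : Adj n
  G = cayley n (S₁₂ n)

  ΣF-window : (h : ℕ → ℚ) → (∀ m → h (11 ℕ.+ m) ≡ 0ℚ) →
              ΣF (λ x → h (offset x)) ≡ ΣF {11} (h ∘ toℕ)
  ΣF-window h h-vanishes = trans (ΣF-offset h) (ΣF-prefix 11≤n h h-vanishes)

  ΣF-window-⟦⟧ : ∀ (v : ℕ → Form) α → (∀ m → v (11 ℕ.+ m) ≡ 𝟘) →
    ΣF (λ x → ⟦ v (offset x) ⟧ α) ≡ ⟦ ΣForm {11} (v ∘ toℕ) ⟧ α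
  ΣF-window-⟦⟧ v α v-vanishes =
    trans (ΣF-window (λ m → ⟦ v m ⟧ α) λ m → trans (cong (λ u → ⟦ u ⟧ α) (v-vanishes m)) (⟦𝟘⟧ α))
          (ΣF-⟦⟧ {11} (v ∘ toℕ) α)

  cayley-vertex : ∀ {a} → 2 ≤ a → a ℕ.+ 2 < n → ∀ y →
                  G (vertex a) y ≡ isNeighbour a (offset y)
  cayley-vertex {a} 2≤a a+2<n y =
    cong₂ _∨_ (eqF-step 1 (m<n⇒m%n≡m (ℕP.≤-<-trans (ℕP.+-monoʳ-≤ a (s≤s z≤n)) a+2<n))) (
    cong₂ _∨_ (eqF-step (n ∸ 1) ([a+[n∸r]]%n≡a∸r (ℕP.≤-trans (s≤s z≤n) 2≤a) a<n)) (
    cong₂ _∨_ (eqF-step 2 (m<n⇒m%n≡m a+2<n)) (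
    cong₂ _∨_ (eqF-step (n ∸ 2) ([a+[n∸r]]%n≡a∸r 2≤a a<n)) refl)))
    where
    a<n : a < n
    a<n = ℕP.≤-<-trans (ℕP.m≤m+n a 2) a+2<n
    eqF-step : ∀ s {m} → (a ℕ.+ s) % n ≡ m → eqF (shift n (vertex a) s) y ≡ (m ℕ.≡ᵇ offset y)
    eqF-step s {m} a+s≡m = begin
      eqF (shift n (vertex a) s) y       ≡⟨ cong (λ z → eqF z y) (vertex-shift a s) ⟩
      eqF (vertex ((a ℕ.+ s) % n)) y     ≡⟨ eqF-vertex (m%n<n (a ℕ.+ s) n) y ⟩
      ((a ℕ.+ s) % n ℕ.≡ᵇ offset y)      ≡⟨ cong (ℕ._≡ᵇ offset y) a+s≡m ⟩
      (m ℕ.≡ᵇ offset y)                  ∎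
      where open ≡-Reasoning

  deg-vertex₆ : deg G (vertex 6) ≡ 4
  deg-vertex₆ = ℕtoℚ-injective (begin
    ℕtoℚ (deg G (vertex 6))
      ≡⟨ ℕtoℚ-countF (G (vertex 6)) ⟩
    ΣF (λ y → if G (vertex 6) y then 1ℚ else 0ℚ)
      ≡⟨ ΣF-cong (λ y → cong (if_then 1ℚ else 0ℚ) (cayley-vertex 2≤6 8<n y)) ⟩
    ΣF (λ y → if isNeighbour 6 (offset y) then 1ℚ else 0ℚ)
      ≡⟨ ΣF-window (λ m → if isNeighbour 6 m then 1ℚ else 0ℚ) (λ _ → refl) ⟩
    ℕtoℚ 4 ∎)
    where
    open ≡-Reasoning
    2≤6 : 2 ≤ 6
    2≤6 = from-yes (2 ≤? 6)
    8<n : 8 < n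
    8<n = ℕP.<-≤-trans (from-yes (8 <? 11)) 11≤n

deg-S₁₂ : ∀ {n} .{{_ : NonZero n}} → 11 ≤ n → ∀ x → deg (cayley n (S₁₂ n)) x ≡ 4
deg-S₁₂ {n} 11≤n x =
  subst (λ y → deg (cayley n (S₁₂ n)) y ≡ 4) (shift-cancel x 6≤n)
    (Window.deg-vertex₆ n 11≤n (shift n x (n ∸ 6)))
  where
  6≤n : 6 ≤ n
  6≤n = ℕP.≤-trans (from-yes (6 ≤? 11)) 11≤n

-- μ^α at the vertex with offset a, as a function of offsets.
μ̂ : ℕ → ℕ → Form
μ̂ a m = if a ℕ.≡ᵇ m then α̂ else if isNeighbour a m then β̂ else 𝟘

<⇒≡ᵇ-false : ∀ {x y} → x < y → (x ℕ.≡ᵇ y) ≡ false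
<⇒≡ᵇ-false {x} {y} x<y = dec-false (x ℕ.≟ y) (ℕP.<⇒≢ x<y)

μ̂-vanishes : ∀ {a m} → a ℕ.+ 2 < m → μ̂ a m ≡ 𝟘
μ̂-vanishes {a} {m} a+2<m =
  cong₂ (λ c d → if c then α̂ else if d then β̂ else 𝟘) (outside (ℕP.m≤m+n a 2))
    (cong₂ _∨_ (outside (ℕP.+-monoʳ-≤ a (s≤s z≤n))) (cong₂ _∨_ (outside (a∸ 1 ≤a+2))
      (cong₂ _∨_ (outside ℕP.≤-refl) (cong₂ _∨_ (outside (a∸ 2 ≤a+2)) (refl {x = false})))))
  where
  outside : ∀ {x} → x ≤ a ℕ.+ 2 → (x ℕ.≡ᵇ m) ≡ false
  outside x≤a+2 = <⇒≡ᵇ-false (ℕP.≤-<-trans x≤a+2 a+2<m)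
  a∸_≤a+2 : ∀ r → a ∸ r ≤ a ℕ.+ 2
  a∸ r ≤a+2 = ℕP.≤-trans (ℕP.m∸n≤m a r) (ℕP.m≤m+n a 2)

moved : ℕ → (ℕ → ℕ) → ℕ → ℕ → Form
moved a hop i j = if i ℕ.+ hop i ℕ.≡ᵇ j then μ̂ a i else 𝟘

-- Everything needed to certify W₁(μ^α at offset a, μ^α at offset a') = ⟦ w ⟧ α, read off the window:
-- a transport plan moving each offset i forward by hop i ∈ {0, 1, 2}, and a 1-Lipschitz potential φ.
record Certificate (a a' : ℕ) (w : Form) : Set where
  field
    hop            : ℕ → Fin 3
    transports     : ∀ j → ΣForm {11} (λ i → moved a (toℕ ∘ hop) (toℕ i) j) ≡ μ̂ a' j
    transport-cost : ΣForm {11} (λ i → ℕtoℚ ⌈ toℕ (hop (toℕ i)) /2⌉ ⊙ μ̂ a (toℕ i)) ≡ w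
    φ              : ℕ → ℕ
    φ-lipschitz    : Lipschitz₂ φ
    φ-seam         : ∀ m → m ≤ 1 ⊎ 9 ≤ m → φ m ≤ 1
    φ≤3            : ∀ m → φ m ≤ 3
    φ-gap          : ΣForm {11} (λ i → ℕtoℚ (φ (toℕ i)) ⊙ μ̂ a (toℕ i)) ≡
                     w ⊕ ΣForm {11} (λ i → ℕtoℚ (φ (toℕ i)) ⊙ μ̂ a' (toℕ i))

module Transport (n : ℕ) .{{_ : NonZero n}} (11≤n : 11 ≤ n) (b : Fin n) where
  open Window n 11≤n b public

  private
    <11⇒<n : ∀ {m} → m < 11 → m < n
    <11⇒<n m<11 = ℕP.<-≤-trans m<11 11≤n

  μ-vertex : ∀ {a} → 2 ≤ a → a ℕ.+ 2 < 11 → ∀ α y →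
             μ G α (vertex a) y ≡ ⟦ μ̂ a (offset y) ⟧ α
  μ-vertex {a} 2≤a a+2<11 α y = begin
    mass (eqF (vertex a) y) (G (vertex a) y) (deg G (vertex a))
      ≡⟨ cong₂ (λ c d → mass c d (deg G (vertex a)))
               (eqF-vertex a<n y) (cayley-vertex 2≤a (<11⇒<n a+2<11) y) ⟩
    mass (a ℕ.≡ᵇ offset y) (isNeighbour a (offset y)) (deg G (vertex a))
      ≡⟨ cong (mass (a ℕ.≡ᵇ offset y) (isNeighbour a (offset y))) (deg-S₁₂ 11≤n (vertex a)) ⟩
    mass (a ℕ.≡ᵇ offset y) (isNeighbour a (offset y)) 4
      ≡⟨ mass₄ (a ℕ.≡ᵇ offset y) (isNeighbour a (offset y)) ⟩
    ⟦ μ̂ a (offset y) ⟧ α ∎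
    where
    open ≡-Reasoning
    a<n : a < n
    a<n = <11⇒<n (ℕP.≤-<-trans (ℕP.m≤m+n a 2) a+2<11)
    mass : Bool → Bool → ℕ → ℚ
    mass c d δ = if c then α else if d then (1ℚ - α) ÷' ℕtoℚ δ else 0ℚ
    mass₄ : ∀ c d → mass c d 4 ≡ ⟦ if c then α̂ else if d then β̂ else 𝟘 ⟧ α
    mass₄ true  _     = solve 2 (λ α β → α := con 1ℚ :* α :+ con 0ℚ :* β) refl α (β α)
    mass₄ false true  = solve 2 (λ α β → β := con 0ℚ :* α :+ con 1ℚ :* β) refl α (β α)
    mass₄ false false = sym (⟦𝟘⟧ α)

  eqF-shift : ∀ x s y → eqF (shift n x s) y ≡ ((offset x ℕ.+ s) % n ℕ.≡ᵇ offset y)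
  eqF-shift x s y = begin
    eqF (shift n x s) y                    ≡⟨ cong (λ z → eqF z y) (vertex-offset (shift n x s)) ⟨
    eqF (vertex (offset (shift n x s))) y  ≡⟨ cong (λ m → eqF (vertex m) y) (offset-shift x s) ⟩
    eqF (vertex ((offset x ℕ.+ s) % n)) y  ≡⟨ eqF-vertex (m%n<n (offset x ℕ.+ s) n) y ⟩
    ((offset x ℕ.+ s) % n ℕ.≡ᵇ offset y)   ∎
    where open ≡-Reasoning

  translateBy : (ℕ → ℕ) → Fin n → Fin n
  translateBy hop x = shift n x (hop (offset x))

  dist-translateBy : ∀ hop → (∀ i → hop i ≤ 2) → ∀ x →
                     dist G x (translateBy hop x) ≡ ⌈ hop (offset x) /2⌉
  dist-translateBy hop hop≤2 x = dist-shift (ℕP.≤-trans (from-yes (3 ≤? 11)) 11≤n) x (hop≤2 (offset x))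

  module _ {a} (2≤a : 2 ≤ a) (a+2<11 : a ℕ.+ 2 < 11) (α : ℚ) where

    private
      a+2<11+_ : ∀ m → a ℕ.+ 2 < 11 ℕ.+ m
      a+2<11+ m = ℕP.<-≤-trans a+2<11 (ℕP.m≤m+n 11 m)

    μ-vertex-ΣF : ∀ (g : ℕ → ℚ) →
      ΣF (λ x → g (offset x) * μ G α (vertex a) x) ≡
      ⟦ ΣForm {11} (λ i → g (toℕ i) ⊙ μ̂ a (toℕ i)) ⟧ α
    μ-vertex-ΣF g = trans
      (ΣF-cong λ x → trans (cong (g (offset x) *_) (μ-vertex 2≤a a+2<11 α x))
                           (sym (⟦⊙⟧ (g (offset x)) (μ̂ a (offset x)) α)))
      (ΣF-window-⟦⟧ (λ i → g i ⊙ μ̂ a i) α λ m →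
        trans (cong (g (11 ℕ.+ m) ⊙_) (μ̂-vanishes (a+2<11+ m))) (⊙-zeroʳ (g (11 ℕ.+ m))))

    transportPlan-column : a ℕ.+ 4 < 11 → ∀ hop → (∀ i → hop i ≤ 2) → ∀ y →
      ΣF (λ x → transportPlan (translateBy hop) (μ G α (vertex a)) x y) ≡
      ⟦ ΣForm {11} (λ i → moved a hop (toℕ i) (offset y)) ⟧ α
    transportPlan-column a+4<11 hop hop≤2 y = trans (ΣF-cong plan-entry)
      (ΣF-window-⟦⟧ (λ i → moved a hop i (offset y)) α λ m →
        trans (cong (λ u → if 11 ℕ.+ m ℕ.+ hop (11 ℕ.+ m) ℕ.≡ᵇ offset y then u else 𝟘)
                    (μ̂-vanishes (a+2<11+ m)))
              (if-eta (11 ℕ.+ m ℕ.+ hop (11 ℕ.+ m) ℕ.≡ᵇ offset y)))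
      where
      open ≡-Reasoning
      if-⟦⟧ : ∀ c u → (if c then ⟦ u ⟧ α else 0ℚ) ≡ ⟦ if c then u else 𝟘 ⟧ α
      if-⟦⟧ true  u = refl
      if-⟦⟧ false u = sym (⟦𝟘⟧ α)
      plan-entry : ∀ x → transportPlan (translateBy hop) (μ G α (vertex a)) x y ≡
                         ⟦ moved a hop (offset x) (offset y) ⟧ α
      plan-entry x with offset x ≤? a ℕ.+ 2
      ... | yes i≤a+2 = begin
        (if eqF (translateBy hop x) y then μ G α (vertex a) x else 0ℚ)
          ≡⟨ cong₂ (λ c u → if c then u else 0ℚ)
                   (eqF-shift x (hop (offset x)) y) (μ-vertex 2≤a a+2<11 α x) ⟩
        (if (offset x ℕ.+ hop (offset x)) % n ℕ.≡ᵇ offset y then ⟦ μ̂ a (offset x) ⟧ α else 0ℚ)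
          ≡⟨ cong (λ c → if c ℕ.≡ᵇ offset y then ⟦ μ̂ a (offset x) ⟧ α else 0ℚ)
                  (m<n⇒m%n≡m (<11⇒<n i+hop<11)) ⟩
        (if offset x ℕ.+ hop (offset x) ℕ.≡ᵇ offset y then ⟦ μ̂ a (offset x) ⟧ α else 0ℚ)
          ≡⟨ if-⟦⟧ (offset x ℕ.+ hop (offset x) ℕ.≡ᵇ offset y) (μ̂ a (offset x)) ⟩
        ⟦ moved a hop (offset x) (offset y) ⟧ α ∎
        where
        i+hop<11 : offset x ℕ.+ hop (offset x) < 11
        i+hop<11 = ℕP.≤-<-trans (ℕP.+-mono-≤ i≤a+2 (hop≤2 (offset x)))
                                (subst (_< 11) (sym (ℕP.+-assoc a 2 2)) a+4<11)
      ... | no  i≰a+2 = begin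
        (if eqF (translateBy hop x) y then μ G α (vertex a) x else 0ℚ)
          ≡⟨ cong (λ u → if eqF (translateBy hop x) y then u else 0ℚ)
                  (trans (μ-vertex 2≤a a+2<11 α x) μ̂≡0) ⟩
        (if eqF (translateBy hop x) y then 0ℚ else 0ℚ)
          ≡⟨ if-eta (eqF (translateBy hop x) y) ⟩
        0ℚ
          ≡⟨ trans (cong (λ u → ⟦ u ⟧ α) (trans (cong (λ u → if c then u else 𝟘) μ̂-outside) (if-eta c)))
                   (⟦𝟘⟧ α) ⟨
        ⟦ moved a hop (offset x) (offset y) ⟧ α ∎
        where
        c : Bool
        c = offset x ℕ.+ hop (offset x) ℕ.≡ᵇ offset y
        μ̂-outside : μ̂ a (offset x) ≡ 𝟘
        μ̂-outside = μ̂-vanishes (ℕP.≰⇒> i≰a+2)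
        μ̂≡0 : ⟦ μ̂ a (offset x) ⟧ α ≡ 0ℚ
        μ̂≡0 = trans (cong (λ u → ⟦ u ⟧ α) μ̂-outside) (⟦𝟘⟧ α)

    cost-translateBy : ∀ hop → (∀ i → hop i ≤ 2) →
      cost G (transportPlan (translateBy hop) (μ G α (vertex a))) ≡
      ⟦ ΣForm {11} (λ i → ℕtoℚ ⌈ hop (toℕ i) /2⌉ ⊙ μ̂ a (toℕ i)) ⟧ α
    cost-translateBy hop hop≤2 = begin
      cost G (transportPlan (translateBy hop) (μ G α (vertex a)))
        ≡⟨ cost-transportPlan G (translateBy hop) (μ G α (vertex a)) ⟩
      ΣF (λ x → ℕtoℚ (dist G x (translateBy hop x)) * μ G α (vertex a) x)
        ≡⟨ ΣF-cong (λ x → cong (λ d → ℕtoℚ d * μ G α (vertex a) x)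
                               (dist-translateBy hop hop≤2 x)) ⟩
      ΣF (λ x → ℕtoℚ ⌈ hop (offset x) /2⌉ * μ G α (vertex a) x)
        ≡⟨ μ-vertex-ΣF (λ i → ℕtoℚ ⌈ hop i /2⌉) ⟩
      ⟦ ΣForm {11} (λ i → ℕtoℚ ⌈ hop (toℕ i) /2⌉ ⊙ μ̂ a (toℕ i)) ⟧ α ∎
      where open ≡-Reasoning

  potential-lipschitz : ∀ {φ} → Lipschitz₂ φ → (∀ m → m ≤ 1 ⊎ 9 ≤ m → φ m ≤ 1) →
    (∀ m → φ m ≤ 3) →
    ∀ x y → ℕtoℚ (φ (offset x)) ℚ.≤ ℕtoℚ (dist G x y) + ℕtoℚ (φ (offset y))
  potential-lipschitz {φ} φ-lip φ-seam φ≤3 x y =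
    subst (ℕtoℚ (φ (offset x)) ℚ.≤_) (ℕtoℚ-+ (dist G x y) (φ (offset y)))
      (ℕtoℚ-mono-≤ (dist-lipschitz G (φ ∘ offset) (offset-lipschitz b 2≤n φ-lip near-seam)
                                   (λ z → ℕP.≤-trans (φ≤3 (offset z)) 3≤n) x y))
    where
    3≤n : 3 ≤ n
    3≤n = ℕP.≤-trans (from-yes (3 ≤? 11)) 11≤n
    2≤n : 2 ≤ n
    2≤n = ℕP.≤-trans (from-yes (2 ≤? 11)) 11≤n
    near-seam : ∀ m → NearSeam n m → φ m ≤ 1
    near-seam m (inj₁ m≤1)   = φ-seam m (inj₁ m≤1)
    near-seam m (inj₂ n≤m+2) = φ-seam m (inj₂ (ℕP.+-cancelʳ-≤ 2 9 m (ℕP.≤-trans 11≤n n≤m+2)))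

  certificate⇒IsW1 : ∀ {a a' w} → 2 ≤ a → a ℕ.+ 4 < 11 → 2 ≤ a' → a' ℕ.+ 2 < 11 →
    Certificate a a' w → ∀ α → 0ℚ ℚ.≤ α → α ℚ.≤ 1ℚ →
    IsW1 G (μ G α (vertex a)) (μ G α (vertex a')) (⟦ w ⟧ α)
  certificate⇒IsW1 {a} {a'} {w} 2≤a a+4<11 2≤a' a'+2<11 cert α α≥0 α≤1 =
    IsW1-intro G (⟦ w ⟧ α) (λ x → ℕtoℚ (φ (offset x))) plan-isCoupling plan-cost
      (potential-lipschitz φ-lipschitz φ-seam φ≤3) potential-gap
    where
    open Certificate cert
    open ≡-Reasoning
    a+2<11 : a ℕ.+ 2 < 11
    a+2<11 = ℕP.≤-<-trans (ℕP.+-monoʳ-≤ a (from-yes (2 ≤? 4))) a+4<11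
    hop′ : ℕ → ℕ
    hop′ = toℕ ∘ hop
    hop′≤2 : ∀ i → hop′ i ≤ 2
    hop′≤2 i = ℕP.≤-pred (toℕ<n (hop i))
    μₐ μₐ' : Fin n → ℚ
    μₐ  = μ G α (vertex a)
    μₐ' = μ G α (vertex a')
    plan-isCoupling : IsCoupling μₐ μₐ' (transportPlan (translateBy hop′) μₐ)
    plan-isCoupling =
      transportPlan-isCoupling {σ = translateBy hop′} (μ-nonNeg G α≥0 α≤1 (vertex a)) λ y → begin
      ΣF (λ x → transportPlan (translateBy hop′) μₐ x y)
        ≡⟨ transportPlan-column 2≤a a+2<11 α a+4<11 hop′ hop′≤2 y ⟩
      ⟦ ΣForm {11} (λ i → moved a hop′ (toℕ i) (offset y)) ⟧ α
        ≡⟨ cong (λ u → ⟦ u ⟧ α) (transports (offset y)) ⟩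
      ⟦ μ̂ a' (offset y) ⟧ α
        ≡⟨ μ-vertex 2≤a' a'+2<11 α y ⟨
      μₐ' y ∎
    plan-cost : cost G (transportPlan (translateBy hop′) μₐ) ≡ ⟦ w ⟧ α
    plan-cost = trans (cost-translateBy 2≤a a+2<11 α hop′ hop′≤2) (cong (λ u → ⟦ u ⟧ α) transport-cost)
    potential-gap : ΣF (λ x → ℕtoℚ (φ (offset x)) * μₐ x) ≡
                    ⟦ w ⟧ α + ΣF (λ y → ℕtoℚ (φ (offset y)) * μₐ' y)
    potential-gap = begin
      ΣF (λ x → ℕtoℚ (φ (offset x)) * μₐ x)
        ≡⟨ μ-vertex-ΣF 2≤a a+2<11 α (ℕtoℚ ∘ φ) ⟩
      ⟦ ΣForm {11} (λ i → ℕtoℚ (φ (toℕ i)) ⊙ μ̂ a (toℕ i)) ⟧ α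
        ≡⟨ cong (λ u → ⟦ u ⟧ α) φ-gap ⟩
      ⟦ w ⊕ ΣForm {11} (λ i → ℕtoℚ (φ (toℕ i)) ⊙ μ̂ a' (toℕ i)) ⟧ α
        ≡⟨ ⟦⊕⟧ w _ α ⟩
      ⟦ w ⟧ α + ⟦ ΣForm {11} (λ i → ℕtoℚ (φ (toℕ i)) ⊙ μ̂ a' (toℕ i)) ⟧ α
        ≡⟨ cong (_+_ (⟦ w ⟧ α)) (μ-vertex-ΣF 2≤a' a'+2<11 α (ℕtoℚ ∘ φ)) ⟨
      ⟦ w ⟧ α + ΣF (λ y → ℕtoℚ (φ (offset y)) * μₐ' y) ∎

hopA : ℕ → Fin 3
hopA 4 = 2F
hopA 6 = 1F
hopA 7 = 2F
hopA _ = 0F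

certificateA : Certificate 6 7 (1ℚ , ℕtoℚ 2)
certificateA = record
  { hop            = hopA
  ; transports     = transports
  ; transport-cost = refl
  ; φ              = cone 4
  ; φ-lipschitz    = cone-lipschitz 4
  ; φ-seam         = λ m seam → ℕP.≤-trans (ℕP.m≤m⊔n (cone 4 m) (cone 5 m)) (cones-seam m seam)
  ; φ≤3            = cone-≤3 4
  ; φ-gap          = refl
  }
  where
  transports : ∀ j → ΣForm {11} (λ i → moved 6 (toℕ ∘ hopA) (toℕ i) j) ≡ μ̂ 7 j
  transports 0 = refl
  transports 1 = refl
  transports 2 = refl
  transports 3 = refl
  transports 4 = refl
  transports 5 = refl
  transports 6 = refl
  transports 7 = refl
  transports 8 = refl
  transports 9 = refl
  transports 10 = refl
  transports (suc (suc (suc (suc (suc (suc (suc (suc (suc (suc (suc j))))))))))) = refl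

hopB : ℕ → Fin 3
hopB 4 = 2F
hopB 5 = 2F
hopB 6 = 2F
hopB 7 = 2F
hopB 8 = 2F
hopB _ = 0F

certificateB : Certificate 6 8 (1ℚ , ℕtoℚ 4)
certificateB = record
  { hop            = hopB
  ; transports     = transports
  ; transport-cost = refl
  ; φ              = λ m → cone 4 m ⊔ cone 5 m
  ; φ-lipschitz    = ⊔-lipschitz (cone-lipschitz 4) (cone-lipschitz 5)
  ; φ-seam         = cones-seam
  ; φ≤3            = λ m → ℕP.⊔-lub (cone-≤3 4 m) (cone-≤3 5 m)
  ; φ-gap          = refl
  }
  where
  transports : ∀ j → ΣForm {11} (λ i → moved 6 (toℕ ∘ hopB) (toℕ i) j) ≡ μ̂ 8 j
  transports 0 = refl
  transports 1 = refl
  transports 2 = refl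
  transports 3 = refl
  transports 4 = refl
  transports 5 = refl
  transports 6 = refl
  transports 7 = refl
  transports 8 = refl
  transports 9 = refl
  transports 10 = refl
  transports (suc (suc (suc (suc (suc (suc (suc (suc (suc (suc (suc j))))))))))) = refl

⌈s/2⌉≡1 : ∀ {s} → 1 ≤ s → s ≤ 2 → ⌈ s /2⌉ ≡ 1
⌈s/2⌉≡1 {1} _ _ = refl
⌈s/2⌉≡1 {2} _ _ = refl
⌈s/2⌉≡1 {suc (suc (suc _))} _ (s≤s (s≤s ()))

module _ (n : ℕ) .{{_ : NonZero n}} (11≤n : 11 ≤ n) (b : Fin n) where
  open Transport n 11≤n b

  RicciIs-edge : ∀ s {w} L → 1 ≤ s → s ≤ 2 → Certificate 6 (6 ℕ.+ s) w →
    (∀ α → 1ℚ - ⟦ w ⟧ α ≡ L * (1ℚ - α)) → RicciIs G (vertex 6) (shift n (vertex 6) s) L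
  RicciIs-edge s {w} L 1≤s s≤2 cert W-affine =
    subst (λ y → RicciIs G (vertex 6) y L) (sym shift≡vertex)
      (RicciIs-intro G (vertex 6) (vertex (6 ℕ.+ s)) ⟦ w ⟧ L dist≡1
        (certificate⇒IsW1 2≤6 (from-yes (6 ℕ.+ 4 <? 11)) (ℕP.≤-trans 2≤6 (ℕP.m≤m+n 6 s))
                        (s≤s (ℕP.+-monoˡ-≤ 2 (ℕP.+-monoʳ-≤ 6 s≤2))) cert)
        W-affine)
    where
    2≤6 : 2 ≤ 6
    2≤6 = from-yes (2 ≤? 6)
    3≤n : 3 ≤ n
    3≤n = ℕP.≤-trans (from-yes (3 ≤? 11)) 11≤n
    shift≡vertex : shift n (vertex 6) s ≡ vertex (6 ℕ.+ s)
    shift≡vertex = trans (vertex-shift 6 s) (cong vertex (m<n⇒m%n≡m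
      (ℕP.<-≤-trans (s≤s (ℕP.≤-trans (ℕP.+-monoʳ-≤ 6 s≤2) (from-yes (8 ≤? 10)))) 11≤n)))
    dist≡1 : dist G (vertex 6) (vertex (6 ℕ.+ s)) ≡ 1
    dist≡1 = trans (cong (dist G (vertex 6)) (sym shift≡vertex))
                   (trans (dist-shift 3≤n (vertex 6) s≤2) (⌈s/2⌉≡1 1≤s s≤2))

-- In the solver terms β α appears as (1 - α) * ¼: ÷' by the literal 4 computes to that.
κα-typeA : ∀ α → 1ℚ - ⟦ 1ℚ , ℕtoℚ 2 ⟧ α ≡ (+ 1 / 2) * (1ℚ - α)
κα-typeA α = solve 1 (λ α → con 1ℚ :- (con 1ℚ :* α :+ con (ℕtoℚ 2) :* ((con 1ℚ :- α) :* con (+ 1 / 4)))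
                             := con (+ 1 / 2) :* (con 1ℚ :- α)) refl α

κα-typeB : ∀ α → 1ℚ - ⟦ 1ℚ , ℕtoℚ 4 ⟧ α ≡ 0ℚ * (1ℚ - α)
κα-typeB α = solve 1 (λ α → con 1ℚ :- (con 1ℚ :* α :+ con (ℕtoℚ 4) :* ((con 1ℚ :- α) :* con (+ 1 / 4)))
                             := con 0ℚ :* (con 1ℚ :- α)) refl α

proposition8 : (n : ℕ) .{{_ : NonZero n}} → 11 ≤ n → (g : Fin n) →
    RicciIs (cayley n (S₁₂ n)) g (shift n g 1) (+ 1 / 2) ×
    RicciIs (cayley n (S₁₂ n)) g (shift n g 2) 0ℚ
proposition8 n 11≤n g =
  subst (λ x → RicciIs (cayley n (S₁₂ n)) x (shift n x 1) (+ 1 / 2)) g-at-6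
    (RicciIs-edge n 11≤n b 1 (+ 1 / 2) ℕP.≤-refl (s≤s z≤n) certificateA κα-typeA) ,
  subst (λ x → RicciIs (cayley n (S₁₂ n)) x (shift n x 2) 0ℚ) g-at-6
    (RicciIs-edge n 11≤n b 2 0ℚ (s≤s z≤n) ℕP.≤-refl certificateB κα-typeB)
  where
  b : Fin n
  b = shift n g (n ∸ 6)
  g-at-6 : Offsets.vertex n b 6 ≡ g
  g-at-6 = shift-cancel g (ℕP.≤-trans (from-yes (6 ≤? 11)) 11≤n)
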